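{- For $X,Y\in 2^\omega$ the following are equivalent: (1) $X\le_{\omega_1^{\mathrm{ck}}\mathrm{T}} Y$; (2) both $X$ and its complement $\omega\setminus X$ are higher $Y$-c.e.
   Context: A functional is a set $\Phi$ of pairs $(\tau,\sigma)$ of finite binary strings (no consistency required), with $\Phi(Y)=\bigcup\{\sigma:(\tau,\sigma)\in\Phi,\ \tau\preceq Y\}$; $X\le_{\omega_1^{\mathrm{ck}}\mathrm{T}}Y$ means $\Phi(Y)=X$ for some $\Pi^1_1$ functional $\Phi$. An enumeration functional is a set $\Psi$ of pairs $(\tau,m)$ with $\tau$ a string and $m\in\omega$, with $\Psi^Y=\{m:(\tau,m)\in\Psi,\ \tau\preceq Y\}$; a set $B\subseteq\omega$ is higher $Y$-c.e. if $B=\Psi^Y$ for some $\Pi^1_1$ enumeration functional $\Psi$. -}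

module Defs where

open import Data.Nat using (ℕ; zero; suc; _+_; _*_)
open import Data.Bool using (Bool; true; false; not)
open import Data.Fin using (Fin)
open import Data.List using (List; []; _∷_)
open import Data.Maybe using (Maybe; just; nothing)
open import Data.Product using (Σ; _×_; _,_; ∃)
open import Data.Sum using (_⊎_)
open import Data.Unit using (⊤)
open import Data.Empty using (⊥)
open import Relation.Binary.PropositionalEquality using (_≡_)
open import Function.Bundles using (_⇔_)

Real : Set
Real = ℕ → Bool          -- an element of 2^ω (identified with a subset of ω)

Str : Set
Str = List Bool

_≼_ : Str → Real → Set
[] ≼ Y = ⊤
(b ∷ τ) ≼ Y = (b ≡ Y 0) × (τ ≼ (λ i → Y (suc i)))

bit : Str → ℕ → Maybe Bool
bit [] m = nothing
bit (b ∷ σ) zero = just b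
bit (b ∷ σ) (suc m) = bit σ m

-- bijective base-2 coding of binary strings
codeStr : Str → ℕ
codeStr [] = 0
codeStr (false ∷ s) = suc (2 * codeStr s)
codeStr (true ∷ s) = suc (suc (2 * codeStr s))

tri : ℕ → ℕ
tri zero = zero
tri (suc k) = suc k + tri k

pair : ℕ → ℕ → ℕ
pair a b = tri (a + b) + b

-- Second-order arithmetic: terms and formulas
-- (k set variables, n number variables, de Bruijn indices)

data Term (n : ℕ) : Set where
  var  : Fin n → Term n
  zer  : Term n
  succ : Term n → Term n
  plus : Term n → Term n → Term n
  times : Term n → Term n → Term n

data Formula (k n : ℕ) : Set where
  eq   : Term n → Term n → Formula k n
  mem  : Term n → Fin k → Formula k n
  fls  : Formula k n
  conj : Formula k n → Formula k n → Formula k n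
  disj : Formula k n → Formula k n → Formula k n
  impl : Formula k n → Formula k n → Formula k n
  allN : Formula k (suc n) → Formula k n
  exN  : Formula k (suc n) → Formula k n

extend : {n : ℕ} → ℕ → (Fin n → ℕ) → Fin (suc n) → ℕ
extend a ρ Fin.zero = a
extend a ρ (Fin.suc i) = ρ i

evalT : {n : ℕ} → Term n → (Fin n → ℕ) → ℕ
evalT (var i) ρ = ρ i
evalT zer ρ = 0
evalT (succ t) ρ = suc (evalT t ρ)
evalT (plus t u) ρ = evalT t ρ + evalT u ρ
evalT (times t u) ρ = evalT t ρ * evalT u ρ

Sat : {k n : ℕ} → Formula k n → (Fin k → Real) → (Fin n → ℕ) → Set
Sat (eq t u) S ρ = evalT t ρ ≡ evalT u ρ
Sat (mem t i) S ρ = S i (evalT t ρ) ≡ true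
Sat fls S ρ = ⊥
Sat (conj φ ψ) S ρ = Sat φ S ρ × Sat ψ S ρ
Sat (disj φ ψ) S ρ = Sat φ S ρ ⊎ Sat ψ S ρ
Sat (impl φ ψ) S ρ = Sat φ S ρ → Sat ψ S ρ
Sat (allN φ) S ρ = (a : ℕ) → Sat φ S (extend a ρ)
Sat (exN φ) S ρ = Σ ℕ (λ a → Sat φ S (extend a ρ))

Π¹₁Holds : Formula 1 1 → ℕ → Set
Π¹₁Holds φ x = (Z : Real) → Sat φ (λ _ → Z) (λ _ → x)

IsΠ¹₁ : (ℕ → Set) → Set
IsΠ¹₁ A = Σ (Formula 1 1) (λ φ → (x : ℕ) → A x ⇔ Π¹₁Holds φ x)

Functional : Set₁
Functional = Str → Str → Set

IsΠ¹₁Functional : Functional → Set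
IsΠ¹₁Functional Φ =
  Σ (Formula 1 1) (λ φ → (τ σ : Str) →
      Φ τ σ ⇔ Π¹₁Holds φ (pair (codeStr τ) (codeStr σ)))

-- Φ(Y) = X : the union of all σ with (τ,σ) ∈ Φ and τ ≼ Y is exactly X
_applied_≡_ : Functional → Real → Real → Set
Φ applied Y ≡ X = (m : ℕ) →
    Σ Str (λ τ → Σ Str (λ σ → Φ τ σ × τ ≼ Y × bit σ m ≡ just (X m)))
  × ((τ σ : Str) → Φ τ σ → τ ≼ Y → bit σ m ≡ just (not (X m)) → ⊥)

_≤ω₁T_ : Real → Real → Set₁
X ≤ω₁T Y = Σ Functional (λ Φ → IsΠ¹₁Functional Φ × Φ applied Y ≡ X)

EnumFunctional : Set₁
EnumFunctional = Str → ℕ → Set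

IsΠ¹₁EnumFunctional : EnumFunctional → Set
IsΠ¹₁EnumFunctional Ψ =
  Σ (Formula 1 1) (λ φ → (τ : Str) (m : ℕ) →
      Ψ τ m ⇔ Π¹₁Holds φ (pair (codeStr τ) m))

_^_∋_ : EnumFunctional → Real → ℕ → Set
Ψ ^ Y ∋ m = Σ Str (λ τ → Ψ τ m × τ ≼ Y)

HigherCE : (ℕ → Set) → Real → Set₁
HigherCE B Y = Σ EnumFunctional (λ Ψ → IsΠ¹₁EnumFunctional Ψ ×
                  ((m : ℕ) → B m ⇔ (Ψ ^ Y ∋ m)))

-- The Π¹₁ sets here are the sets {x : ∀ Z φ(Z, x)} with φ arithmetical.  They
-- are closed under ∧, ∀ over ω and hypotheses arithmetical in an oracle O,
-- provided O is the unique set satisfying some arithmetical formula: quantify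
-- over all Z whose odd half satisfies that formula, hence is O, and let the
-- even half of Z serve every Π¹₁ conjunct.  Taking for O the graphs of bit
-- extraction from string codes and of lookup in coded lists, "n = |τ|",
-- "u codes τ ↾ a" and "ℓ is entry i of the list coded by n" are arithmetical
-- in O, and are used as hypotheses ∀ n (n = |τ| → …).
--
-- (1) ⇒ (2): (τ, m) ∈ Ψ_b iff |τ| = ⟨a, codeStr σ⟩ with (τ ↾ a, σ) ∈ Φ and
-- σ(m) = b.  A witness (τ₀, σ) for Φ(Y)(m) = b is found again in the prefix
-- of Y of length ⟨|τ₀|, codeStr σ⟩.
-- (2) ⇒ (1): (τ, σ) ∈ Φ iff (τ ↾ ℓᵢ, i) ∈ Ψ_{σ(i)} for all i < |σ|, where |τ|
-- codes the list ℓ.  Prefixes of Y whose length codes the lengths of witnesses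
-- for X(0), …, X(m) give σ = X ↾ (m+1); consistency holds because X and its
-- complement are disjoint.

module Submission where

open import Defs
open import Data.Nat using (ℕ; zero; suc; _+_; _*_; _∸_; _≤_; _<_; z≤n; s≤s; _≟_; ⌊_/2⌋)
open import Data.Nat.Properties
open import Data.Nat.Tactic.RingSolver using (solve-∀)
open import Data.Bool using (Bool; true; false; not; if_then_else_)
open import Data.Bool.Properties using (not-¬; ¬-not) renaming (_≟_ to _≟ᵇ_)
open import Data.Maybe using (Maybe; just; nothing)
open import Data.Maybe.Properties using (just-injective)
open import Data.List using ([]; _∷_; length; take)
open import Data.Fin using (Fin; #_)
open import Data.Product using (Σ; _×_; _,_; proj₁; proj₂)
open import Data.Product.Function.NonDependent.Propositional using (_×-⇔_)
open import Data.Sum using (_⊎_; inj₁; inj₂)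
open import Data.Sum.Function.Propositional using (_⊎-⇔_)
open import Data.Unit using (tt)
open import Data.Empty using (⊥; ⊥-elim)
open import Function.Bundles using (_⇔_; mk⇔; Equivalence)
open import Function.Properties.Equivalence using ()
  renaming (refl to ⇔-refl; sym to ⇔-sym; trans to ⇔-trans)
open import Function.Related.TypeIsomorphisms using (→-cong-⇔)
open import Relation.Nullary using (Dec; does; yes; no)
open import Relation.Binary using (tri<; tri≈; tri>)
open import Relation.Binary.PropositionalEquality
  using (_≡_; refl; sym; trans; cong; cong₂; subst; subst₂; module ≡-Reasoning)

open Equivalence using (to; from)

infixr 1 _⟨⇔⟩_
_⟨⇔⟩_ : {A B C : Set} → A ⇔ B → B ⇔ C → A ⇔ C
_⟨⇔⟩_ = ⇔-trans

≡⇒⇔ : {A B : Set} → A ≡ B → A ⇔ B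
≡⇒⇔ refl = ⇔-refl

Π-cong-⇔ : {A B : ℕ → Set} → (∀ a → A a ⇔ B a) → ((a : ℕ) → A a) ⇔ ((a : ℕ) → B a)
Π-cong-⇔ A⇔B = mk⇔ (λ f a → to (A⇔B a) (f a)) (λ f a → from (A⇔B a) (f a))

Σ-cong-⇔ : {A B : ℕ → Set} → (∀ a → A a ⇔ B a) → Σ ℕ A ⇔ Σ ℕ B
Σ-cong-⇔ A⇔B = mk⇔ (λ (a , x) → a , to (A⇔B a) x) (λ (a , x) → a , from (A⇔B a) x)

×→⇔ : {A B : Set} → ((A → B) × (B → A)) ⇔ (A ⇔ B)
×→⇔ = mk⇔ (λ (f , g) → mk⇔ f g) (λ e → to e , from e)

⇔-cong-⇔ : {A B C D : Set} → A ⇔ C → B ⇔ D → (A ⇔ B) ⇔ (C ⇔ D)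
⇔-cong-⇔ A⇔C B⇔D = mk⇔ (λ e → ⇔-sym A⇔C ⟨⇔⟩ e ⟨⇔⟩ B⇔D) (λ e → A⇔C ⟨⇔⟩ e ⟨⇔⟩ ⇔-sym B⇔D)

∀-pinned-⇔ : {D P : ℕ → Set} (v₀ : ℕ) → (∀ v → D v ⇔ v ≡ v₀) →
  ((v : ℕ) → D v → P v) ⇔ P v₀
∀-pinned-⇔ {P = P} v₀ D⇔ =
  mk⇔ (λ f → f v₀ (from (D⇔ v₀) refl)) (λ p v d → subst P (sym (to (D⇔ v) d)) p)

∀²-pinned-⇔ : {D P : ℕ → ℕ → Set} (v₀ w₀ : ℕ) → (∀ v w → D v w ⇔ (v ≡ v₀ × w ≡ w₀)) →
  ((v w : ℕ) → D v w → P v w) ⇔ P v₀ w₀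
∀²-pinned-⇔ {P = P} v₀ w₀ D⇔ = mk⇔
  (λ f → f v₀ w₀ (from (D⇔ v₀ w₀) (refl , refl)))
  (λ p v w d → case (to (D⇔ v w) d) p)
  where
  case : ∀ {v w} → v ≡ v₀ × w ≡ w₀ → P v₀ w₀ → P v w
  case (refl , refl) p = p

Σ-pinnedˡ-⇔ : {P : Set} (t₀ : ℕ) → Σ ℕ (λ t → t ≡ t₀ × P) ⇔ P
Σ-pinnedˡ-⇔ t₀ = mk⇔ (λ (_ , _ , p) → p) (λ p → t₀ , refl , p)

Σ-pinnedʳ-⇔ : {P : Set} (t₀ : ℕ) → Σ ℕ (λ t → P × t ≡ t₀) ⇔ P
Σ-pinnedʳ-⇔ t₀ = mk⇔ (λ (_ , p , _) → p) (λ p → t₀ , p , refl)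

substTerm : ∀ {n m} → (Fin n → Term m) → Term n → Term m
substTerm σ (var i) = σ i
substTerm σ zer = zer
substTerm σ (succ t) = succ (substTerm σ t)
substTerm σ (plus t u) = plus (substTerm σ t) (substTerm σ u)
substTerm σ (times t u) = times (substTerm σ t) (substTerm σ u)

evalT-substTerm : ∀ {n m} (σ : Fin n → Term m) (t : Term n) (ρ : Fin m → ℕ) →
  evalT (substTerm σ t) ρ ≡ evalT t (λ i → evalT (σ i) ρ)
evalT-substTerm σ (var i) ρ = refl
evalT-substTerm σ zer ρ = refl
evalT-substTerm σ (succ t) ρ = cong suc (evalT-substTerm σ t ρ)
evalT-substTerm σ (plus t u) ρ = cong₂ _+_ (evalT-substTerm σ t ρ) (evalT-substTerm σ u ρ)
evalT-substTerm σ (times t u) ρ = cong₂ _*_ (evalT-substTerm σ t ρ) (evalT-substTerm σ u ρ)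

evalT-cong : ∀ {n} (t : Term n) {ρ ρ' : Fin n → ℕ} → (∀ i → ρ i ≡ ρ' i) →
  evalT t ρ ≡ evalT t ρ'
evalT-cong (var i) e = e i
evalT-cong zer e = refl
evalT-cong (succ t) e = cong suc (evalT-cong t e)
evalT-cong (plus t u) e = cong₂ _+_ (evalT-cong t e) (evalT-cong u e)
evalT-cong (times t u) e = cong₂ _*_ (evalT-cong t e) (evalT-cong u e)

wk : ∀ {n} → Term n → Term (suc n)
wk = substTerm (λ i → var (Fin.suc i))

wk² : ∀ {n} → Term n → Term (suc (suc n))
wk² t = wk (wk t)

wk³ : ∀ {n} → Term n → Term (suc (suc (suc n)))
wk³ t = wk (wk² t)

evalT-wk : ∀ {n} (t : Term n) a (ρ : Fin n → ℕ) → evalT (wk t) (extend a ρ) ≡ evalT t ρ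
evalT-wk t a ρ = evalT-substTerm (λ i → var (Fin.suc i)) t (extend a ρ)

evalT-wk² : ∀ {n} (t : Term n) a b (ρ : Fin n → ℕ) →
  evalT (wk² t) (extend b (extend a ρ)) ≡ evalT t ρ
evalT-wk² t a b ρ = trans (evalT-wk (wk t) b (extend a ρ)) (evalT-wk t a ρ)

evalT-wk³ : ∀ {n} (t : Term n) a b c (ρ : Fin n → ℕ) →
  evalT (wk³ t) (extend c (extend b (extend a ρ))) ≡ evalT t ρ
evalT-wk³ t a b c ρ = trans (evalT-wk (wk² t) c _) (evalT-wk² t a b ρ)

extend-cong : ∀ {n} {ρ ρ' : Fin n → ℕ} a → (∀ i → ρ i ≡ ρ' i) →
  ∀ i → extend a ρ i ≡ extend a ρ' i
extend-cong a e Fin.zero = refl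
extend-cong a e (Fin.suc i) = e i

liftSubst : ∀ {n m} → (Fin n → Term m) → Fin (suc n) → Term (suc m)
liftSubst σ Fin.zero = var Fin.zero
liftSubst σ (Fin.suc i) = wk (σ i)

-- Besides substituting σ, each membership atom t ∈ Z becomes f t ∈ Z; with
-- f t = 2t or 2t+1 this replaces Z by its even or odd half.
substFormula : (∀ {m} → Term m → Term m) → ∀ {k n m} → Formula k n → (Fin n → Term m) → Formula k m
substFormula f (eq t u) σ = eq (substTerm σ t) (substTerm σ u)
substFormula f (mem t i) σ = mem (f (substTerm σ t)) i
substFormula f fls σ = fls
substFormula f (conj φ ψ) σ = conj (substFormula f φ σ) (substFormula f ψ σ)
substFormula f (disj φ ψ) σ = disj (substFormula f φ σ) (substFormula f ψ σ)
substFormula f (impl φ ψ) σ = impl (substFormula f φ σ) (substFormula f ψ σ)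
substFormula f (allN φ) σ = allN (substFormula f φ (liftSubst σ))
substFormula f (exN φ) σ = exN (substFormula f φ (liftSubst σ))

Sat-cong : ∀ {k n} (φ : Formula k n) {S S' : Fin k → Real} {ρ ρ' : Fin n → ℕ} →
  (∀ j x → S j x ≡ S' j x) → (∀ i → ρ i ≡ ρ' i) → Sat φ S ρ ⇔ Sat φ S' ρ'
Sat-cong (eq t u) eS eρ = ≡⇒⇔ (cong₂ _≡_ (evalT-cong t eρ) (evalT-cong u eρ))
Sat-cong (mem t i) {S' = S'} {ρ = ρ} eS eρ =
  ≡⇒⇔ (cong (_≡ true) (trans (eS i (evalT t ρ)) (cong (S' i) (evalT-cong t eρ))))
Sat-cong fls eS eρ = ⇔-refl
Sat-cong (conj φ ψ) eS eρ = Sat-cong φ eS eρ ×-⇔ Sat-cong ψ eS eρ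
Sat-cong (disj φ ψ) eS eρ = Sat-cong φ eS eρ ⊎-⇔ Sat-cong ψ eS eρ
Sat-cong (impl φ ψ) eS eρ = →-cong-⇔ (Sat-cong φ eS eρ) (Sat-cong ψ eS eρ)
Sat-cong (allN φ) eS eρ = Π-cong-⇔ (λ a → Sat-cong φ eS (extend-cong a eρ))
Sat-cong (exN φ) eS eρ = Σ-cong-⇔ (λ a → Sat-cong φ eS (extend-cong a eρ))

module _ (f : ∀ {m} → Term m → Term m) (F : ℕ → ℕ)
         (f-eval : ∀ {m} (t : Term m) (ρ : Fin m → ℕ) → evalT (f t) ρ ≡ F (evalT t ρ)) where

  evalT-liftSubst : ∀ {n m} (σ : Fin n → Term m) a (ρ : Fin m → ℕ) (i : Fin (suc n)) →
    evalT (liftSubst σ i) (extend a ρ) ≡ extend a (λ i → evalT (σ i) ρ) i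
  evalT-liftSubst σ a ρ Fin.zero = refl
  evalT-liftSubst σ a ρ (Fin.suc i) = evalT-wk (σ i) a ρ

  Sat-substFormula : ∀ {k n m} (φ : Formula k n) (σ : Fin n → Term m) (S : Fin k → Real) (ρ : Fin m → ℕ) →
    Sat (substFormula f φ σ) S ρ ⇔ Sat φ (λ j x → S j (F x)) (λ i → evalT (σ i) ρ)
  Sat-substFormula (eq t u) σ S ρ = ≡⇒⇔ (cong₂ _≡_ (evalT-substTerm σ t ρ) (evalT-substTerm σ u ρ))
  Sat-substFormula (mem t i) σ S ρ =
    ≡⇒⇔ (cong (λ x → S i x ≡ true) (trans (f-eval (substTerm σ t) ρ) (cong F (evalT-substTerm σ t ρ))))
  Sat-substFormula fls σ S ρ = ⇔-refl
  Sat-substFormula (conj φ ψ) σ S ρ = Sat-substFormula φ σ S ρ ×-⇔ Sat-substFormula ψ σ S ρ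
  Sat-substFormula (disj φ ψ) σ S ρ = Sat-substFormula φ σ S ρ ⊎-⇔ Sat-substFormula ψ σ S ρ
  Sat-substFormula (impl φ ψ) σ S ρ = →-cong-⇔ (Sat-substFormula φ σ S ρ) (Sat-substFormula ψ σ S ρ)
  Sat-substFormula (allN φ) σ S ρ = Π-cong-⇔ λ a →
    Sat-substFormula φ (liftSubst σ) S (extend a ρ) ⟨⇔⟩ Sat-cong φ (λ _ _ → refl) (evalT-liftSubst σ a ρ)
  Sat-substFormula (exN φ) σ S ρ = Σ-cong-⇔ λ a →
    Sat-substFormula φ (liftSubst σ) S (extend a ρ) ⟨⇔⟩ Sat-cong φ (λ _ _ → refl) (evalT-liftSubst σ a ρ)

oddBit : ℕ → ℕ
oddBit zero = 0
oddBit (suc zero) = 1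
oddBit (suc (suc n)) = oddBit n

⌊1+n+n/2⌋≡n : ∀ n → ⌊ suc (n + n) /2⌋ ≡ n
⌊1+n+n/2⌋≡n zero = refl
⌊1+n+n/2⌋≡n (suc n) rewrite +-suc n n = cong suc (⌊1+n+n/2⌋≡n n)

oddBit-even : ∀ n → oddBit (n + n) ≡ 0
oddBit-even zero = refl
oddBit-even (suc n) rewrite +-suc n n = oddBit-even n

oddBit-odd : ∀ n → oddBit (suc (n + n)) ≡ 1
oddBit-odd zero = refl
oddBit-odd (suc n) rewrite +-suc n n = oddBit-odd n

even-or-odd : ∀ n → (n ≡ ⌊ n /2⌋ + ⌊ n /2⌋ × oddBit n ≡ 0)
                  ⊎ (n ≡ suc (⌊ n /2⌋ + ⌊ n /2⌋) × oddBit n ≡ 1)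
even-or-odd zero = inj₁ (refl , refl)
even-or-odd (suc zero) = inj₂ (refl , refl)
even-or-odd (suc (suc n)) with even-or-odd n
... | inj₁ (e , p) = inj₁ (cong suc (trans (cong suc e) (sym (+-suc _ _))) , p)
... | inj₂ (e , p) = inj₂ (cong suc (trans (cong suc e) (cong suc (sym (+-suc _ _)))) , p)

n+n-injective : ∀ {m n} → m + m ≡ n + n → m ≡ n
n+n-injective {m} {n} e = trans (n≡⌊n+n/2⌋ m) (trans (cong ⌊_/2⌋ e) (sym (n≡⌊n+n/2⌋ n)))

2*n≡n+n : ∀ n → 2 * n ≡ n + n
2*n≡n+n n = cong (n +_) (+-identityʳ n)

tri+tri : ∀ s → tri s + tri s ≡ s * suc s
tri+tri zero = refl
tri+tri (suc s) = begin
    (suc s + tri s) + (suc s + tri s)  ≡⟨ rearrange (suc s) (tri s) ⟩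
    (suc s + suc s) + (tri s + tri s)  ≡⟨ cong ((suc s + suc s) +_) (tri+tri s) ⟩
    (suc s + suc s) + s * suc s        ≡⟨ expand s ⟩
    suc s * suc (suc s)                ∎
  where
  open ≡-Reasoning
  rearrange : ∀ a b → (a + b) + (a + b) ≡ (a + a) + (b + b)
  rearrange = solve-∀
  expand : ∀ s → (suc s + suc s) + s * suc s ≡ suc s * suc (suc s)
  expand = solve-∀

-- Twice a pair code is a polynomial in its components, so formulas can
-- express z = ⟨a,b⟩ without defining tri.
pair+pair : ∀ a b → pair a b + pair a b ≡ (a + b) * suc (a + b) + (b + b)
pair+pair a b = trans (rearrange (tri (a + b)) b) (cong (_+ (b + b)) (tri+tri (a + b)))
  where
  rearrange : ∀ t b → (t + b) + (t + b) ≡ (t + t) + (b + b)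
  rearrange = solve-∀

unpair : ℕ → ℕ × ℕ
unpair zero = (0 , 0)
unpair (suc n) = next (unpair n)
  where
  next : ℕ × ℕ → ℕ × ℕ
  next (zero , b) = (suc b , 0)
  next (suc a , b) = (a , suc b)

pair-unpair : ∀ n → pair (proj₁ (unpair n)) (proj₂ (unpair n)) ≡ n
pair-unpair zero = refl
pair-unpair (suc n) with unpair n | pair-unpair n
... | zero , b | refl rewrite +-identityʳ b | +-identityʳ (b + tri b) = cong suc (+-comm b (tri b))
... | suc a , b | refl rewrite +-suc a b = +-suc (tri (suc (a + b))) b

n≤tri : ∀ n → n ≤ tri n
n≤tri zero = z≤n
n≤tri (suc n) = m≤m+n (suc n) (tri n)

tri-mono-≤ : ∀ {m n} → m ≤ n → tri m ≤ tri n
tri-mono-≤ z≤n = z≤n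
tri-mono-≤ (s≤s m≤n) = +-mono-≤ (s≤s m≤n) (tri-mono-≤ m≤n)

m≤pair : ∀ m n → m ≤ pair m n
m≤pair m n = ≤-trans (m≤m+n m n) (≤-trans (n≤tri (m + n)) (m≤m+n (tri (m + n)) n))

n≤pair : ∀ m n → n ≤ pair m n
n≤pair m n = m≤n+m n (tri (m + n))

tri+b<tri : ∀ {s t b} → s < t → b ≤ s → tri s + b < tri t
tri+b<tri {s} {suc t} {b} (s≤s s≤t) b≤s =
  ≤-trans (s≤s (subst (_≤ s + tri s) (+-comm b (tri s)) (+-monoˡ-≤ (tri s) b≤s)))
          (tri-mono-≤ (s≤s s≤t))

pair-injective-sum : ∀ a b a' b' → pair a b ≡ pair a' b' → a + b ≡ a' + b'
pair-injective-sum a b a' b' e with <-cmp (a + b) (a' + b')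
... | tri≈ _ s≡s' _ = s≡s'
... | tri< s<s' _ _ = ⊥-elim (<-irrefl e (<-≤-trans (tri+b<tri s<s' (m≤n+m b a)) (m≤m+n (tri (a' + b')) b')))
... | tri> _ _ s>s' = ⊥-elim (<-irrefl (sym e) (<-≤-trans (tri+b<tri s>s' (m≤n+m b' a')) (m≤m+n (tri (a + b)) b)))

pair-injective : ∀ {a b a' b'} → pair a b ≡ pair a' b' → a ≡ a' × b ≡ b'
pair-injective {a} {b} {a'} {b'} e = a≡a' , b≡b'
  where
  s≡s' = pair-injective-sum a b a' b' e
  b≡b' : b ≡ b'
  b≡b' = +-cancelˡ-≡ (tri (a' + b')) b b' (subst (λ s → tri s + b ≡ tri (a' + b') + b') s≡s' e)
  a≡a' : a ≡ a'
  a≡a' = +-cancelʳ-≡ b a a' (trans s≡s' (cong (a' +_) (sym b≡b')))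

unpair-pair : ∀ a b → unpair (pair a b) ≡ (a , b)
unpair-pair a b with unpair (pair a b) | pair-unpair (pair a b)
... | a' , b' | e with pair-injective {a'} {b'} {a} {b} e
...   | refl , refl = refl

≡pair⇔unpair : ∀ n a b → n ≡ pair a b ⇔ (a ≡ proj₁ (unpair n) × b ≡ proj₂ (unpair n))
≡pair⇔unpair n a b = mk⇔
  (λ { refl → cong proj₁ (sym (unpair-pair a b)) , cong proj₂ (sym (unpair-pair a b)) })
  (λ { (refl , refl) → sym (pair-unpair n) })

pair≡pair⇔ : ∀ a b a' b' → pair a b ≡ pair a' b' ⇔ (a' ≡ a × b' ≡ b)
pair≡pair⇔ a b a' b' = mk⇔ (λ e → let (p , q) = pair-injective e in sym p , sym q)
                            (λ { (refl , refl) → refl })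

incStr : Str → Str
incStr [] = false ∷ []
incStr (false ∷ s) = true ∷ s
incStr (true ∷ s) = false ∷ incStr s

codeStr-incStr : ∀ s → codeStr (incStr s) ≡ suc (codeStr s)
codeStr-incStr [] = refl
codeStr-incStr (false ∷ s) = refl
codeStr-incStr (true ∷ s) = cong suc (trans (cong (2 *_) (codeStr-incStr s)) (*-suc 2 (codeStr s)))

decodeStr : ℕ → Str
decodeStr zero = []
decodeStr (suc n) = incStr (decodeStr n)

codeStr-decodeStr : ∀ n → codeStr (decodeStr n) ≡ n
codeStr-decodeStr zero = refl
codeStr-decodeStr (suc n) = trans (codeStr-incStr (decodeStr n)) (cong suc (codeStr-decodeStr n))

bit≡nothing⇒length≤ : ∀ σ j → bit σ j ≡ nothing → length σ ≤ j
bit≡nothing⇒length≤ [] j e = z≤n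
bit≡nothing⇒length≤ (b ∷ σ) (suc j) e = s≤s (bit≡nothing⇒length≤ σ j e)

bit≡just⇒<length : ∀ σ {j b} → bit σ j ≡ just b → j < length σ
bit≡just⇒<length [] ()
bit≡just⇒<length (c ∷ σ) {zero} _ = s≤s z≤n
bit≡just⇒<length (c ∷ σ) {suc j} e = s≤s (bit≡just⇒<length σ e)

length≤⇒bit≡nothing : ∀ σ j → length σ ≤ j → bit σ j ≡ nothing
length≤⇒bit≡nothing [] j _ = refl
length≤⇒bit≡nothing (b ∷ σ) (suc j) (s≤s le) = length≤⇒bit≡nothing σ j le

bit-extensionality : ∀ σ τ → (∀ j → bit σ j ≡ bit τ j) → σ ≡ τ
bit-extensionality [] [] e = refl
bit-extensionality [] (b ∷ τ) e with e 0
... | ()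
bit-extensionality (b ∷ σ) [] e with e 0
... | ()
bit-extensionality (b ∷ σ) (c ∷ τ) e with e 0
... | refl = cong (b ∷_) (bit-extensionality σ τ (λ j → e (suc j)))

bit-take-< : ∀ a τ j → j < a → bit (take a τ) j ≡ bit τ j
bit-take-< (suc a) [] j lt = refl
bit-take-< (suc a) (b ∷ τ) zero lt = refl
bit-take-< (suc a) (b ∷ τ) (suc j) (s≤s lt) = bit-take-< a τ j lt

bit-take-≥ : ∀ a τ j → a ≤ j → bit (take a τ) j ≡ nothing
bit-take-≥ zero τ j _ = refl
bit-take-≥ (suc a) [] j _ = refl
bit-take-≥ (suc a) (b ∷ τ) (suc j) (s≤s le) = bit-take-≥ a τ j le

take-≼ : ∀ a τ Y → τ ≼ Y → take a τ ≼ Y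
take-≼ zero τ Y _ = tt
take-≼ (suc a) [] Y _ = tt
take-≼ (suc a) (b ∷ τ) Y (e , p) = e , take-≼ a τ (λ i → Y (suc i)) p

prefix : Real → ℕ → Str
prefix Y zero = []
prefix Y (suc n) = Y 0 ∷ prefix (λ i → Y (suc i)) n

prefix-≼ : ∀ Y n → prefix Y n ≼ Y
prefix-≼ Y zero = tt
prefix-≼ Y (suc n) = refl , prefix-≼ (λ i → Y (suc i)) n

≼⇒≡prefix : ∀ τ Y → τ ≼ Y → τ ≡ prefix Y (length τ)
≼⇒≡prefix [] Y _ = refl
≼⇒≡prefix (b ∷ τ) Y (refl , p) = cong (Y 0 ∷_) (≼⇒≡prefix τ (λ i → Y (suc i)) p)

length-prefix : ∀ Y n → length (prefix Y n) ≡ n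
length-prefix Y zero = refl
length-prefix Y (suc n) = cong suc (length-prefix (λ i → Y (suc i)) n)

take-prefix : ∀ Y {a n} → a ≤ n → take a (prefix Y n) ≡ prefix Y a
take-prefix Y {zero} _ = refl
take-prefix Y {suc a} {suc n} (s≤s le) = cong (Y 0 ∷_) (take-prefix (λ i → Y (suc i)) le)

bit-prefix : ∀ X {k i} → i < k → bit (prefix X k) i ≡ just (X i)
bit-prefix X {suc k} {zero} _ = refl
bit-prefix X {suc k} {suc i} (s≤s lt) = bit-prefix (λ j → X (suc j)) lt

readAt : (ℕ → ℕ) → (ℕ → ℕ) → ℕ → ℕ → ℕ
readAt g h x zero = g x
readAt g h x (suc i) = readAt g h (h x) i

encBit : Maybe Bool → ℕ
encBit nothing = 0
encBit (just false) = 1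
encBit (just true) = 2

encBit-injective : ∀ x y → encBit x ≡ encBit y → x ≡ y
encBit-injective nothing nothing e = refl
encBit-injective (just false) (just false) e = refl
encBit-injective (just true) (just true) e = refl
encBit-injective nothing (just false) ()
encBit-injective nothing (just true) ()
encBit-injective (just false) nothing ()
encBit-injective (just false) (just true) ()
encBit-injective (just true) nothing ()
encBit-injective (just true) (just false) ()

-- codeStr (b ∷ s) = 1 + 2·codeStr s + [b = true]: the head bit and the
-- tail are read off by parity and halving.
headCode : ℕ → ℕ
headCode zero = zero
headCode (suc n) = suc (oddBit n)

tailCode : ℕ → ℕ
tailCode zero = zero
tailCode (suc n) = ⌊ n /2⌋

tailCode-codeStr : ∀ b s → tailCode (codeStr (b ∷ s)) ≡ codeStr s
tailCode-codeStr false s rewrite 2*n≡n+n (codeStr s) = sym (n≡⌊n+n/2⌋ (codeStr s))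
tailCode-codeStr true s rewrite 2*n≡n+n (codeStr s) = ⌊1+n+n/2⌋≡n (codeStr s)

headCode-codeStr : ∀ b s → headCode (codeStr (b ∷ s)) ≡ encBit (just b)
headCode-codeStr false s rewrite 2*n≡n+n (codeStr s) = cong suc (oddBit-even (codeStr s))
headCode-codeStr true s rewrite 2*n≡n+n (codeStr s) = cong suc (oddBit-odd (codeStr s))

bitCode : ℕ → ℕ → ℕ
bitCode = readAt headCode tailCode

bitCode-codeStr : ∀ σ i → bitCode (codeStr σ) i ≡ encBit (bit σ i)
bitCode-codeStr [] zero = refl
bitCode-codeStr [] (suc i) = bitCode-codeStr [] i
bitCode-codeStr (b ∷ σ) zero = headCode-codeStr b σ
bitCode-codeStr (b ∷ σ) (suc i) rewrite tailCode-codeStr b σ = bitCode-codeStr σ i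

bitCode-codeStr-nothing : ∀ σ i → bitCode (codeStr σ) i ≡ 0 → bit σ i ≡ nothing
bitCode-codeStr-nothing σ i e = encBit-injective _ nothing (trans (sym (bitCode-codeStr σ i)) e)

listHead listTail : ℕ → ℕ
listHead n = proj₁ (unpair n)
listTail n = proj₂ (unpair n)

listAt : ℕ → ℕ → ℕ
listAt = readAt listHead listTail

codeList : (ℕ → ℕ) → ℕ → ℕ
codeList f zero = 0
codeList f (suc k) = pair (f 0) (codeList (λ i → f (suc i)) k)

listAt-codeList : ∀ k f {i} → i < k → listAt (codeList f k) i ≡ f i
listAt-codeList (suc k) f {zero} _ = cong proj₁ (unpair-pair (f 0) _)
listAt-codeList (suc k) f {suc i} (s≤s lt)
  rewrite cong proj₂ (unpair-pair (f 0) (codeList (λ i → f (suc i)) k)) = listAt-codeList k (λ i → f (suc i)) lt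

≤codeList : ∀ k f {i} → i < k → f i ≤ codeList f k
≤codeList (suc k) f {zero} _ = m≤pair (f 0) _
≤codeList (suc k) f {suc i} (s≤s lt) = ≤-trans (≤codeList k (λ i → f (suc i)) lt) (n≤pair (f 0) _)

-- Length and prefixes through bitCode, with the bounded quantifier
-- ∀ j < n written as ∀ j k. j + suc k ≡ n → ….

+suc≡⇒< : ∀ {j k n} → j + suc k ≡ n → j < n
+suc≡⇒< {j} refl = m<m+n j (s≤s z≤n)

<⇒+suc≡ : ∀ {j n} → j < n → j + suc (n ∸ suc j) ≡ n
<⇒+suc≡ {j} {n} lt = trans (+-suc j _) (m+[n∸m]≡n lt)

IsLength : ℕ → ℕ → Set
IsLength s n = (bitCode s n ≡ 0) × (∀ j k → j + suc k ≡ n → bitCode s j ≡ 0 → ⊥)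

IsLength-⇔ : ∀ τ n → IsLength (codeStr τ) n ⇔ n ≡ length τ
IsLength-⇔ τ n = mk⇔ unique (λ { refl → bitCode-length , below })
  where
  bitCode-length : bitCode (codeStr τ) (length τ) ≡ 0
  bitCode-length = trans (bitCode-codeStr τ (length τ)) (cong encBit (length≤⇒bit≡nothing τ _ ≤-refl))
  below : ∀ j k → j + suc k ≡ length τ → bitCode (codeStr τ) j ≡ 0 → ⊥
  below j k e d = <⇒≱ (+suc≡⇒< e) (bit≡nothing⇒length≤ τ j (bitCode-codeStr-nothing τ j d))
  unique : IsLength (codeStr τ) n → n ≡ length τ
  unique (d , h) with <-cmp n (length τ)
  ... | tri≈ _ n≡ _ = n≡
  ... | tri< n< _ _ = ⊥-elim (<⇒≱ n< (bit≡nothing⇒length≤ τ n (bitCode-codeStr-nothing τ n d)))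
  ... | tri> _ _ n> = ⊥-elim (h (length τ) _ (<⇒+suc≡ n>) bitCode-length)

IsPrefix : ℕ → ℕ → ℕ → Set
IsPrefix u s a = (bitCode u a ≡ 0) × (∀ j k → j + suc k ≡ a → bitCode u j ≡ bitCode s j)

IsPrefix-⇔ : ∀ u τ a → IsPrefix u (codeStr τ) a ⇔ u ≡ codeStr (take a τ)
IsPrefix-⇔ u τ a = mk⇔ unique (λ { refl → take-end , take-below })
  where
  take-end : bitCode (codeStr (take a τ)) a ≡ 0
  take-end = trans (bitCode-codeStr (take a τ) a) (cong encBit (bit-take-≥ a τ a ≤-refl))
  take-below : ∀ j k → j + suc k ≡ a → bitCode (codeStr (take a τ)) j ≡ bitCode (codeStr τ) j
  take-below j k e = trans (bitCode-codeStr (take a τ) j)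
    (trans (cong encBit (bit-take-< a τ j (+suc≡⇒< e))) (sym (bitCode-codeStr τ j)))
  unique : IsPrefix u (codeStr τ) a → u ≡ codeStr (take a τ)
  unique (d , f) = trans (sym (codeStr-decodeStr u)) (cong codeStr (bit-extensionality υ (take a τ) bits))
    where
    υ = decodeStr u
    bitCode-υ : ∀ j → bitCode (codeStr υ) j ≡ bitCode u j
    bitCode-υ j = cong (λ w → bitCode w j) (codeStr-decodeStr u)
    |υ|≤a : length υ ≤ a
    |υ|≤a = bit≡nothing⇒length≤ υ a (bitCode-codeStr-nothing υ a (trans (bitCode-υ a) d))
    bits : ∀ j → bit υ j ≡ bit (take a τ) j
    bits j with <-cmp j a
    ... | tri< j<a _ _ = trans
      (encBit-injective _ _ (trans (sym (bitCode-codeStr υ j))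
        (trans (bitCode-υ j) (trans (f j _ (<⇒+suc≡ j<a)) (bitCode-codeStr τ j)))))
      (sym (bit-take-< a τ j j<a))
    ... | tri≈ _ refl _ = trans (length≤⇒bit≡nothing υ j |υ|≤a) (sym (bit-take-≥ a τ j ≤-refl))
    ... | tri> _ _ j>a = trans (length≤⇒bit≡nothing υ j (≤-trans |υ|≤a (<⇒≤ j>a)))
                               (sym (bit-take-≥ a τ j (<⇒≤ j>a)))

data Half : Set where
  evens odds : Half

halfIndex : Half → ℕ → ℕ
halfIndex evens k = k + k
halfIndex odds k = suc (k + k)

halfTerm : Half → ∀ {m} → Term m → Term m
halfTerm evens t = plus t t
halfTerm odds t = succ (plus t t)

evalT-halfTerm : ∀ h {m} (t : Term m) (ρ : Fin m → ℕ) → evalT (halfTerm h t) ρ ≡ halfIndex h (evalT t ρ)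
evalT-halfTerm evens t ρ = refl
evalT-halfTerm odds t ρ = refl

join : Real → Real → Real
join A B n with oddBit n
... | zero = A ⌊ n /2⌋
... | suc _ = B ⌊ n /2⌋

join-evens : ∀ (A B : Real) k → join A B (halfIndex evens k) ≡ A k
join-evens A B k with oddBit (k + k) | oddBit-even k
... | .zero | refl = cong A (sym (n≡⌊n+n/2⌋ k))

join-odds : ∀ (A B : Real) k → join A B (halfIndex odds k) ≡ B k
join-odds A B k with oddBit (suc (k + k)) | oddBit-odd k
... | .1 | refl = cong B (⌊1+n+n/2⌋≡n k)

join-unique : ∀ (A B C : Real) → (∀ k → C (halfIndex evens k) ≡ A k) → (∀ k → C (halfIndex odds k) ≡ B k) →
  ∀ n → C n ≡ join A B n
join-unique A B C ce co n with even-or-odd n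
... | inj₁ (e , _) = subst (λ w → C w ≡ join A B w) (sym e) (trans (ce ⌊ n /2⌋) (sym (join-evens A B ⌊ n /2⌋)))
... | inj₂ (e , _) = subst (λ w → C w ≡ join A B w) (sym e) (trans (co ⌊ n /2⌋) (sym (join-odds A B ⌊ n /2⌋)))

does≡true⇔ : {A : Set} (d : Dec A) → does d ≡ true ⇔ A
does≡true⇔ (yes a) = mk⇔ (λ _ → a) (λ _ → refl)
does≡true⇔ (no ¬a) = mk⇔ (λ ()) (λ a → ⊥-elim (¬a a))

≡true⇔⇒≡ : ∀ (b c : Bool) → (b ≡ true ⇔ c ≡ true) → b ≡ c
≡true⇔⇒≡ true true e = refl
≡true⇔⇒≡ true false e = sym (to e refl)
≡true⇔⇒≡ false true e = from e refl
≡true⇔⇒≡ false false e = refl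

graph : (ℕ → ℕ) → (ℕ → ℕ) → Real
graph g h k = does (v ≟ readAt g h x i)
  where
  x = proj₁ (unpair k)
  i = proj₁ (unpair (proj₂ (unpair k)))
  v = proj₂ (unpair (proj₂ (unpair k)))

graph-⇔ : ∀ g h x i v → graph g h (pair x (pair i v)) ≡ true ⇔ v ≡ readAt g h x i
graph-⇔ g h x i v rewrite unpair-pair x (pair i v) | unpair-pair i v = does≡true⇔ (v ≟ readAt g h x i)

graph-unique : ∀ g h (B : Real) → (∀ x i v → B (pair x (pair i v)) ≡ true ⇔ v ≡ readAt g h x i) →
  ∀ k → B k ≡ graph g h k
graph-unique g h B B⇔ k = subst (λ w → B w ≡ graph g h w) pair-unpair³
  (≡true⇔⇒≡ _ _ (B⇔ x i v ⟨⇔⟩ ⇔-sym (graph-⇔ g h x i v)))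
  where
  x = proj₁ (unpair k)
  i = proj₁ (unpair (proj₂ (unpair k)))
  v = proj₂ (unpair (proj₂ (unpair k)))
  pair-unpair³ : pair x (pair i v) ≡ k
  pair-unpair³ = trans (cong (pair x) (pair-unpair (proj₂ (unpair k)))) (pair-unpair k)

O : Real
O = join (graph headCode tailCode) (graph listHead listTail)

O-evens-⇔ : ∀ x i v → O (halfIndex evens (pair x (pair i v))) ≡ true ⇔ v ≡ bitCode x i
O-evens-⇔ x i v =
  ≡⇒⇔ (cong (_≡ true) (join-evens (graph headCode tailCode) (graph listHead listTail) (pair x (pair i v))))
  ⟨⇔⟩ graph-⇔ headCode tailCode x i v

O-odds-⇔ : ∀ x i v → O (halfIndex odds (pair x (pair i v))) ≡ true ⇔ v ≡ listAt x i
O-odds-⇔ x i v =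
  ≡⇒⇔ (cong (_≡ true) (join-odds (graph headCode tailCode) (graph listHead listTail) (pair x (pair i v))))
  ⟨⇔⟩ graph-⇔ listHead listTail x i v

iff : ∀ {k m} → Formula k m → Formula k m → Formula k m
iff A B = conj (impl A B) (impl B A)

PairF : ∀ {m} → Term m → Term m → Term m → Formula 1 m
PairF z a b = eq (plus z z) (plus (times (plus a b) (succ (plus a b))) (plus b b))

PairF-⇔ : ∀ {m} (z a b : Term m) S ρ → Sat (PairF z a b) S ρ ⇔ evalT z ρ ≡ pair (evalT a ρ) (evalT b ρ)
PairF-⇔ z a b S ρ = mk⇔
  (λ e → n+n-injective (trans e (sym (pair+pair (evalT a ρ) (evalT b ρ)))))
  (λ e → trans (cong (λ w → w + w) e) (pair+pair (evalT a ρ) (evalT b ρ)))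

GraphAtom : Half → ∀ {m} → Term m → Term m → Term m → Formula 1 m
GraphAtom h x i v = exN (exN (conj (PairF (var (# 1)) (wk² i) (wk² v))
                                   (conj (PairF (var (# 0)) (wk² x) (var (# 1)))
                                         (mem (halfTerm h (var (# 0))) Fin.zero))))

GraphAtom-⇔ : ∀ h {m} (x i v : Term m) (S : Fin 1 → Real) ρ →
  Sat (GraphAtom h x i v) S ρ ⇔ S Fin.zero (halfIndex h (pair (evalT x ρ) (pair (evalT i ρ) (evalT v ρ)))) ≡ true
GraphAtom-⇔ h x i v S ρ = mk⇔ forth back
  where
  X = evalT x ρ
  I = evalT i ρ
  V = evalT v ρ
  inZ : ℕ → Set
  inZ k = S Fin.zero (halfIndex h k) ≡ true
  forth : Sat (GraphAtom h x i v) S ρ → inZ (pair X (pair I V))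
  forth (r , k , e₁ , e₂ , k∈Z) =
    subst inZ k≡ (subst (_≡ true) (cong (S Fin.zero) (evalT-halfTerm h (var (# 0)) _)) k∈Z)
    where
    r≡ : r ≡ pair I V
    r≡ = trans (to (PairF-⇔ (var (# 1)) (wk² i) (wk² v) S _) e₁) (cong₂ pair (evalT-wk² i r k ρ) (evalT-wk² v r k ρ))
    k≡ : k ≡ pair X (pair I V)
    k≡ = trans (to (PairF-⇔ (var (# 0)) (wk² x) (var (# 1)) S _) e₂) (cong₂ pair (evalT-wk² x r k ρ) r≡)
  back : inZ (pair X (pair I V)) → Sat (GraphAtom h x i v) S ρ
  back k∈Z = pair I V , pair X (pair I V) ,
    from (PairF-⇔ (var (# 1)) (wk² i) (wk² v) S _) (sym (cong₂ pair (evalT-wk² i _ _ ρ) (evalT-wk² v _ _ ρ))) ,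
    from (PairF-⇔ (var (# 0)) (wk² x) (var (# 1)) S _) (sym (cong₂ pair (evalT-wk² x _ _ ρ) refl)) ,
    subst (_≡ true) (cong (S Fin.zero) (sym (evalT-halfTerm h (var (# 0)) _))) k∈Z

record Definable (f : ℕ → ℕ) : Set where
  field
    graphF : ∀ {m} → Term m → Term m → Formula 1 m
    graphF-⇔ : ∀ {m} (a b : Term m) S ρ → Sat (graphF a b) S ρ ⇔ evalT b ρ ≡ f (evalT a ρ)

module IterationGraph {g h : ℕ → ℕ} (dg : Definable g) (dh : Definable h) (half : Half) where
  open Definable

  IsGraphF : ∀ {m} → Formula 1 m
  IsGraphF = conj
    (allN (allN (iff (GraphAtom half (var (# 1)) zer (var (# 0))) (graphF dg (var (# 1)) (var (# 0))))))
    (allN (allN (allN (iff (GraphAtom half (var (# 2)) (succ (var (# 1))) (var (# 0)))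
                           (exN (conj (graphF dh (var (# 3)) (var (# 0)))
                                      (GraphAtom half (var (# 0)) (var (# 2)) (var (# 1)))))))))

  module _ (B : Real) where
    InGraph : ℕ → ℕ → ℕ → Set
    InGraph x i v = B (halfIndex half (pair x (pair i v))) ≡ true

    IsGraph : Set
    IsGraph = ((x v : ℕ) → InGraph x 0 v ⇔ v ≡ g x) ×
              ((x i v : ℕ) → InGraph x (suc i) v ⇔ Σ ℕ (λ y → y ≡ h x × InGraph y i v))

    IsGraphF-⇔ : ∀ {m} (ρ : Fin m → ℕ) → Sat IsGraphF (λ _ → B) ρ ⇔ IsGraph
    IsGraphF-⇔ ρ =
      (Π-cong-⇔ λ x → Π-cong-⇔ λ v → ×→⇔ ⟨⇔⟩ (⇔-cong-⇔
        (GraphAtom-⇔ half (var (# 1)) zer (var (# 0)) (λ _ → B) _)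
        (graphF-⇔ dg (var (# 1)) (var (# 0)) (λ _ → B) _)))
      ×-⇔
      (Π-cong-⇔ λ x → Π-cong-⇔ λ i → Π-cong-⇔ λ v → ×→⇔ ⟨⇔⟩ (⇔-cong-⇔
        (GraphAtom-⇔ half (var (# 2)) (succ (var (# 1))) (var (# 0)) (λ _ → B) _)
        (Σ-cong-⇔ λ y → graphF-⇔ dh (var (# 3)) (var (# 0)) (λ _ → B) _
                     ×-⇔ GraphAtom-⇔ half (var (# 0)) (var (# 2)) (var (# 1)) (λ _ → B) _)))

    IsGraph-⇔ : IsGraph ⇔ (∀ x i v → InGraph x i v ⇔ v ≡ readAt g h x i)
    IsGraph-⇔ = mk⇔ exact (λ ex → (λ x v → ex x 0 v) , (λ x i v → step ex x i v))
      where
      exact : IsGraph → ∀ x i v → InGraph x i v ⇔ v ≡ readAt g h x i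
      exact (base , _) x zero v = base x v
      exact G@(_ , next) x (suc i) v = next x i v ⟨⇔⟩ (mk⇔
        (λ { (y , refl , y∈) → to (exact G (h x) i v) y∈ })
        (λ e → h x , refl , from (exact G (h x) i v) e))
      step : (∀ x i v → InGraph x i v ⇔ v ≡ readAt g h x i) →
        ∀ x i v → InGraph x (suc i) v ⇔ Σ ℕ (λ y → y ≡ h x × InGraph y i v)
      step ex x i v = ex x (suc i) v ⟨⇔⟩ (mk⇔
        (λ e → h x , refl , from (ex (h x) i v) e)
        (λ { (y , refl , y∈) → to (ex (h x) i v) y∈ }))

-- A nonzero string code is c + 2t with c ∈ {1, 2} its head and t its tail.
DigitSplit : ℕ → ℕ → ℕ → Set
DigitSplit a t c = (a ≡ 0 × t ≡ 0 × c ≡ 0) ⊎ ((c ≡ 1 ⊎ c ≡ 2) × a ≡ c + (t + t))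

DigitSplitF : ∀ {m} → Term m → Term m → Term m → Formula 1 m
DigitSplitF a t c = disj (conj (eq a zer) (conj (eq t zer) (eq c zer)))
                         (conj (disj (eq c (succ zer)) (eq c (succ (succ zer)))) (eq a (plus c (plus t t))))

DigitSplit-codes : ∀ a → DigitSplit a (tailCode a) (headCode a)
DigitSplit-codes zero = inj₁ (refl , refl , refl)
DigitSplit-codes (suc n) with even-or-odd n
... | inj₁ (e , p) rewrite p = inj₂ (inj₁ refl , cong suc e)
... | inj₂ (e , p) rewrite p = inj₂ (inj₂ refl , cong suc e)

DigitSplit-⇔ : ∀ a t c → DigitSplit a t c ⇔ (t ≡ tailCode a × c ≡ headCode a)
DigitSplit-⇔ a t c = mk⇔ forth (λ { (refl , refl) → DigitSplit-codes a })
  where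
  forth : DigitSplit a t c → t ≡ tailCode a × c ≡ headCode a
  forth (inj₁ (refl , refl , refl)) = refl , refl
  forth (inj₂ (inj₁ refl , refl)) = n≡⌊n+n/2⌋ t , cong suc (sym (oddBit-even t))
  forth (inj₂ (inj₂ refl , refl)) = sym (⌊1+n+n/2⌋≡n t) , cong suc (sym (oddBit-odd t))

headCode-definable : Definable headCode
headCode-definable = record
  { graphF = λ a b → exN (DigitSplitF (wk a) (var (# 0)) (wk b))
  ; graphF-⇔ = λ a b S ρ →
      Σ-cong-⇔ (λ t → ≡⇒⇔ (cong₂ (λ A B → DigitSplit A t B) (evalT-wk a t ρ) (evalT-wk b t ρ))
                      ⟨⇔⟩ DigitSplit-⇔ _ t _)
      ⟨⇔⟩ Σ-pinnedˡ-⇔ _ }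

tailCode-definable : Definable tailCode
tailCode-definable = record
  { graphF = λ a b → exN (DigitSplitF (wk a) (wk b) (var (# 0)))
  ; graphF-⇔ = λ a b S ρ →
      Σ-cong-⇔ (λ c → ≡⇒⇔ (cong₂ (λ A B → DigitSplit A B c) (evalT-wk a c ρ) (evalT-wk b c ρ))
                      ⟨⇔⟩ DigitSplit-⇔ _ _ c)
      ⟨⇔⟩ Σ-pinnedʳ-⇔ _ }

listHead-definable : Definable listHead
listHead-definable = record
  { graphF = λ a b → exN (PairF (wk a) (wk b) (var (# 0)))
  ; graphF-⇔ = λ a b S ρ →
      Σ-cong-⇔ (λ t → PairF-⇔ (wk a) (wk b) (var (# 0)) S (extend t ρ)
                      ⟨⇔⟩ ≡⇒⇔ (cong₂ (λ A B → A ≡ pair B t) (evalT-wk a t ρ) (evalT-wk b t ρ))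
                      ⟨⇔⟩ ≡pair⇔unpair _ _ t)
      ⟨⇔⟩ Σ-pinnedʳ-⇔ _ }

listTail-definable : Definable listTail
listTail-definable = record
  { graphF = λ a b → exN (PairF (wk a) (var (# 0)) (wk b))
  ; graphF-⇔ = λ a b S ρ →
      Σ-cong-⇔ (λ t → PairF-⇔ (wk a) (var (# 0)) (wk b) S (extend t ρ)
                      ⟨⇔⟩ ≡⇒⇔ (cong₂ (λ A B → A ≡ pair t B) (evalT-wk a t ρ) (evalT-wk b t ρ))
                      ⟨⇔⟩ ≡pair⇔unpair _ t _)
      ⟨⇔⟩ Σ-pinnedˡ-⇔ _ }

module BitGraph = IterationGraph headCode-definable tailCode-definable evens
module ListGraph = IterationGraph listHead-definable listTail-definable odds

OracleF : ∀ {m} → Formula 1 m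
OracleF = conj BitGraph.IsGraphF ListGraph.IsGraphF

OracleF-⇔ : ∀ {m} (B : Real) (ρ : Fin m → ℕ) → Sat OracleF (λ _ → B) ρ ⇔ (∀ n → B n ≡ O n)
OracleF-⇔ B ρ = mk⇔ forth back
  where
  forth : Sat OracleF (λ _ → B) ρ → ∀ n → B n ≡ O n
  forth (bits , list) = join-unique _ _ B
    (graph-unique _ _ _ (to (BitGraph.IsGraph-⇔ B) (to (BitGraph.IsGraphF-⇔ B ρ) bits)))
    (graph-unique _ _ _ (to (ListGraph.IsGraph-⇔ B) (to (ListGraph.IsGraphF-⇔ B ρ) list)))
  O-graphs : Sat OracleF (λ _ → O) ρ
  O-graphs =
    from (BitGraph.IsGraphF-⇔ O ρ) (from (BitGraph.IsGraph-⇔ O) O-evens-⇔) ,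
    from (ListGraph.IsGraphF-⇔ O ρ) (from (ListGraph.IsGraph-⇔ O) O-odds-⇔)
  back : (∀ n → B n ≡ O n) → Sat OracleF (λ _ → B) ρ
  back B≗O = from (Sat-cong OracleF {λ _ → B} {λ _ → O} {ρ} {ρ} (λ _ → B≗O) (λ _ → refl)) O-graphs

-- Formulas with a Π¹₁ reading

data PosForm (m : ℕ) : Set where
  inst : Formula 1 1 → Term m → PosForm m
  arith : Formula 1 m → PosForm m
  and : PosForm m → PosForm m → PosForm m
  imp : Formula 1 m → PosForm m → PosForm m
  all : PosForm (suc m) → PosForm m

⟦_⟧ : ∀ {m} → PosForm m → (Fin m → ℕ) → Set
⟦ inst φ t ⟧ ρ = Π¹₁Holds φ (evalT t ρ)
⟦ arith A ⟧ ρ = Sat A (λ _ → O) ρ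
⟦ and θ θ' ⟧ ρ = ⟦ θ ⟧ ρ × ⟦ θ' ⟧ ρ
⟦ imp A θ ⟧ ρ = Sat A (λ _ → O) ρ → ⟦ θ ⟧ ρ
⟦ all θ ⟧ ρ = (a : ℕ) → ⟦ θ ⟧ (extend a ρ)

onOdds : ∀ {m} → Formula 1 m → Formula 1 m
onOdds A = substFormula (halfTerm odds) A var

translate : ∀ {m} → PosForm m → Formula 1 m
translate (inst φ t) = substFormula (halfTerm evens) φ (λ _ → t)
translate (arith A) = onOdds A
translate (and θ θ') = conj (translate θ) (translate θ')
translate (imp A θ) = impl (onOdds A) (translate θ)
translate (all θ) = allN (translate θ)

toΠ¹₁ : PosForm 1 → Formula 1 1
toΠ¹₁ θ = impl (onOdds OracleF) (translate θ)

OddsAreO : Real → Set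
OddsAreO Z = ∀ n → Z (halfIndex odds n) ≡ O n

onOdds-⇔ : ∀ {m} (A : Formula 1 m) Z (ρ : Fin m → ℕ) →
  Sat (onOdds A) (λ _ → Z) ρ ⇔ Sat A (λ _ n → Z (halfIndex odds n)) ρ
onOdds-⇔ A Z ρ = Sat-substFormula (halfTerm odds) (halfIndex odds) (evalT-halfTerm odds) A var (λ _ → Z) ρ

onOdds-O-⇔ : ∀ {m} (A : Formula 1 m) Z (ρ : Fin m → ℕ) → OddsAreO Z →
  Sat (onOdds A) (λ _ → Z) ρ ⇔ Sat A (λ _ → O) ρ
onOdds-O-⇔ A Z ρ oddsO = onOdds-⇔ A Z ρ ⟨⇔⟩ Sat-cong A (λ _ → oddsO) (λ _ → refl)

onOdds-OracleF-⇔ : ∀ {m} Z (ρ : Fin m → ℕ) → Sat (onOdds OracleF) (λ _ → Z) ρ ⇔ OddsAreO Z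
onOdds-OracleF-⇔ Z ρ = onOdds-⇔ OracleF Z ρ ⟨⇔⟩ OracleF-⇔ _ ρ

translate-inst-⇔ : ∀ {m} φ (t : Term m) Z ρ →
  Sat (translate (inst φ t)) (λ _ → Z) ρ ⇔ Sat φ (λ _ n → Z (halfIndex evens n)) (λ _ → evalT t ρ)
translate-inst-⇔ φ t Z ρ =
  Sat-substFormula (halfTerm evens) (halfIndex evens) (evalT-halfTerm evens) φ (λ _ → t) (λ _ → Z) ρ

translate-sound : ∀ {m} (θ : PosForm m) Z ρ → OddsAreO Z → ⟦ θ ⟧ ρ → Sat (translate θ) (λ _ → Z) ρ
translate-sound (inst φ t) Z ρ oddsO s = from (translate-inst-⇔ φ t Z ρ) (s _)
translate-sound (arith A) Z ρ oddsO s = from (onOdds-O-⇔ A Z ρ oddsO) s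
translate-sound (and θ θ') Z ρ oddsO (s , s') = translate-sound θ Z ρ oddsO s , translate-sound θ' Z ρ oddsO s'
translate-sound (imp A θ) Z ρ oddsO s a = translate-sound θ Z ρ oddsO (s (to (onOdds-O-⇔ A Z ρ oddsO) a))
translate-sound (all θ) Z ρ oddsO s a = translate-sound θ Z (extend a ρ) oddsO (s a)

-- An instance ∀ Z' φ(Z') is recovered from the sets join Z' O.
translate-complete : ∀ {m} (θ : PosForm m) ρ → (∀ Z → OddsAreO Z → Sat (translate θ) (λ _ → Z) ρ) → ⟦ θ ⟧ ρ
translate-complete (inst φ t) ρ H Z' = to (Sat-cong φ (λ _ → join-evens Z' O) (λ _ → refl))
  (to (translate-inst-⇔ φ t (join Z' O) ρ) (H (join Z' O) (join-odds Z' O)))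
translate-complete (arith A) ρ H = to (onOdds-O-⇔ A (join O O) ρ (join-odds O O)) (H (join O O) (join-odds O O))
translate-complete (and θ θ') ρ H =
  translate-complete θ ρ (λ Z oddsO → proj₁ (H Z oddsO)) , translate-complete θ' ρ (λ Z oddsO → proj₂ (H Z oddsO))
translate-complete (imp A θ) ρ H a = translate-complete θ ρ (λ Z oddsO → H Z oddsO (from (onOdds-O-⇔ A Z ρ oddsO) a))
translate-complete (all θ) ρ H a = translate-complete θ (extend a ρ) (λ Z oddsO → H Z oddsO a)

toΠ¹₁-⇔ : (θ : PosForm 1) (x : ℕ) → Π¹₁Holds (toΠ¹₁ θ) x ⇔ ⟦ θ ⟧ (λ _ → x)
toΠ¹₁-⇔ θ x = mk⇔
  (λ H → translate-complete θ _ (λ Z oddsO → H Z (from (onOdds-OracleF-⇔ {1} Z (λ _ → x)) oddsO)))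
  (λ s Z good → translate-sound θ Z _ (to (onOdds-OracleF-⇔ {1} Z (λ _ → x)) good) s)

BitF ListF : ∀ {m} → Term m → Term m → Term m → Formula 1 m
BitF = GraphAtom evens
ListF = GraphAtom odds

BitF-⇔ : ∀ {m} (x i v : Term m) ρ →
  Sat (BitF x i v) (λ _ → O) ρ ⇔ evalT v ρ ≡ bitCode (evalT x ρ) (evalT i ρ)
BitF-⇔ x i v ρ = GraphAtom-⇔ evens x i v (λ _ → O) ρ ⟨⇔⟩ O-evens-⇔ (evalT x ρ) (evalT i ρ) (evalT v ρ)

ListF-⇔ : ∀ {m} (x i v : Term m) ρ →
  Sat (ListF x i v) (λ _ → O) ρ ⇔ evalT v ρ ≡ listAt (evalT x ρ) (evalT i ρ)
ListF-⇔ x i v ρ = GraphAtom-⇔ odds x i v (λ _ → O) ρ ⟨⇔⟩ O-odds-⇔ (evalT x ρ) (evalT i ρ) (evalT v ρ)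

encBit≡bitCode-⇔ : ∀ x σ i → encBit x ≡ bitCode (codeStr σ) i ⇔ bit σ i ≡ x
encBit≡bitCode-⇔ x σ i = mk⇔
  (λ e → encBit-injective _ _ (trans (sym (bitCode-codeStr σ i)) (sym e)))
  (λ { refl → sym (bitCode-codeStr σ i) })

LenF : ∀ {m} → Term m → Term m → Formula 1 m
LenF s n = conj (BitF s n zer)
  (allN (allN (impl (eq (plus (var (# 1)) (succ (var (# 0)))) (wk² n))
                    (impl (BitF (wk² s) (var (# 1)) zer) fls))))

LenF-⇔ : ∀ {m} (s n : Term m) ρ → Sat (LenF s n) (λ _ → O) ρ ⇔ IsLength (evalT s ρ) (evalT n ρ)
LenF-⇔ s n ρ = (BitF-⇔ s n zer ρ ⟨⇔⟩ mk⇔ sym sym) ×-⇔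
  (Π-cong-⇔ λ j → Π-cong-⇔ λ k → →-cong-⇔
    (≡⇒⇔ (cong (j + suc k ≡_) (evalT-wk² n j k ρ)))
    (→-cong-⇔ (BitF-⇔ (wk² s) (var (# 1)) zer (extend k (extend j ρ))
                 ⟨⇔⟩ ≡⇒⇔ (cong (λ w → 0 ≡ bitCode w j) (evalT-wk² s j k ρ)) ⟨⇔⟩ mk⇔ sym sym)
              ⇔-refl))

PreF : ∀ {m} → Term m → Term m → Term m → Formula 1 m
PreF u s a = conj (BitF u a zer)
  (allN (allN (impl (eq (plus (var (# 1)) (succ (var (# 0)))) (wk² a))
                    (allN (impl (BitF (wk³ s) (var (# 2)) (var (# 0))) (BitF (wk³ u) (var (# 2)) (var (# 0))))))))

PreF-⇔ : ∀ {m} (u s a : Term m) ρ → Sat (PreF u s a) (λ _ → O) ρ ⇔ IsPrefix (evalT u ρ) (evalT s ρ) (evalT a ρ)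
PreF-⇔ u s a ρ = (BitF-⇔ u a zer ρ ⟨⇔⟩ mk⇔ sym sym) ×-⇔
  (Π-cong-⇔ λ j → Π-cong-⇔ λ k → →-cong-⇔
    (≡⇒⇔ (cong (j + suc k ≡_) (evalT-wk² a j k ρ)))
    (Π-cong-⇔ (λ w → →-cong-⇔ (bit-at s w) (bit-at u w)) ⟨⇔⟩
       mk⇔ (λ f → sym (f _ refl)) (λ e w w≡ → trans w≡ (sym e))))
  where
  bit-at : ∀ {j k} (t : Term _) w →
    Sat (BitF (wk³ t) (var (# 2)) (var (# 0))) (λ _ → O) (extend w (extend k (extend j ρ))) ⇔ w ≡ bitCode (evalT t ρ) j
  bit-at {j} {k} t w = BitF-⇔ (wk³ t) (var (# 2)) (var (# 0)) (extend w (extend k (extend j ρ)))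
                        ⟨⇔⟩ ≡⇒⇔ (cong (λ z → w ≡ bitCode z j) (evalT-wk³ t j k w ρ))

all-imp-pinned : ∀ {m} (A : Formula 1 (suc m)) (θ : PosForm (suc m)) (ρ : Fin m → ℕ) v₀ →
  (∀ v → Sat A (λ _ → O) (extend v ρ) ⇔ v ≡ v₀) → ⟦ all (imp A θ) ⟧ ρ ⇔ ⟦ θ ⟧ (extend v₀ ρ)
all-imp-pinned A θ ρ v₀ = ∀-pinned-⇔ v₀

all²-imp-pinned : ∀ {m} (A : Formula 1 (suc (suc m))) (θ : PosForm (suc (suc m))) (ρ : Fin m → ℕ) v₀ w₀ →
  (∀ v w → Sat A (λ _ → O) (extend w (extend v ρ)) ⇔ (v ≡ v₀ × w ≡ w₀)) →
  ⟦ all (all (imp A θ)) ⟧ ρ ⇔ ⟦ θ ⟧ (extend w₀ (extend v₀ ρ))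
all²-imp-pinned A θ ρ v₀ w₀ = ∀²-pinned-⇔ v₀ w₀

-- A hypothesis x = ⟨s, t⟩ with x = ⟨codeStr τ, t₀⟩, followed by n = |s|.
PairLen : PosForm 4 → PosForm 1
PairLen θ = all (all (imp (PairF (var (# 2)) (var (# 1)) (var (# 0)))
                (all (imp (LenF (var (# 2)) (var (# 0))) θ))))

PairLen-⇔ : ∀ (θ : PosForm 4) τ t₀ →
  ⟦ PairLen θ ⟧ (λ _ → pair (codeStr τ) t₀) ⇔
  ⟦ θ ⟧ (extend (length τ) (extend t₀ (extend (codeStr τ) (λ _ → pair (codeStr τ) t₀))))
PairLen-⇔ θ τ t₀ =
  all²-imp-pinned (PairF (var (# 2)) (var (# 1)) (var (# 0))) (all (imp (LenF (var (# 2)) (var (# 0))) θ)) ρ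
    (codeStr τ) t₀
    (λ s t → PairF-⇔ (var (# 2)) (var (# 1)) (var (# 0)) (λ _ → O) (extend t (extend s ρ)) ⟨⇔⟩ pair≡pair⇔ _ _ s t)
  ⟨⇔⟩ all-imp-pinned (LenF (var (# 2)) (var (# 0))) θ ρ₂ (length τ)
    (λ n → LenF-⇔ (var (# 2)) (var (# 0)) (extend n ρ₂) ⟨⇔⟩ IsLength-⇔ τ n)
  where
  ρ : Fin 1 → ℕ
  ρ = λ _ → pair (codeStr τ) t₀
  ρ₂ : Fin 3 → ℕ
  ρ₂ = extend t₀ (extend (codeStr τ) ρ)

-- (1) ⇒ (2)

bitTerm : Bool → ∀ {m} → Term m
bitTerm false = succ zer
bitTerm true = succ (succ zer)

evalT-bitTerm : ∀ b {m} (ρ : Fin m → ℕ) → evalT (bitTerm b) ρ ≡ encBit (just b)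
evalT-bitTerm false ρ = refl
evalT-bitTerm true ρ = refl

length-split : (τ : Str) → Σ ℕ λ a → Σ Str λ σ → length τ ≡ pair a (codeStr σ)
length-split τ = a , decodeStr c , trans (sym (pair-unpair n)) (cong (pair a) (sym (codeStr-decodeStr c)))
  where
  n = length τ
  a = proj₁ (unpair n)
  c = proj₂ (unpair n)

module HigherCEFromFunctional (X Y : Real) (Φ : Functional) (φ : Formula 1 1)
    (Φ⇔ : (τ σ : Str) → Φ τ σ ⇔ Π¹₁Holds φ (pair (codeStr τ) (codeStr σ)))
    (Φ[Y]≡X : Φ applied Y ≡ X) (b : Bool) where

  -- Variables, innermost first: y u c a n m s x.
  body : PosForm 8
  body = and (arith (BitF (var (# 2)) (var (# 5)) (bitTerm b))) (inst φ (var (# 0)))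

  pairLayer : PosForm 7
  pairLayer = all (imp (PairF (var (# 0)) (var (# 1)) (var (# 2))) body)

  prefixLayer : PosForm 6
  prefixLayer = all (imp (PreF (var (# 0)) (var (# 5)) (var (# 2))) pairLayer)

  splitLayer : PosForm 4
  splitLayer = all (all (imp (PairF (var (# 2)) (var (# 1)) (var (# 0))) prefixLayer))

  Ψ : EnumFunctional
  Ψ τ m = Π¹₁Holds (toΠ¹₁ (PairLen splitLayer)) (pair (codeStr τ) m)

  Ψ-⇔ : ∀ τ m a σ → length τ ≡ pair a (codeStr σ) → Ψ τ m ⇔ (bit σ m ≡ just b × Φ (take a τ) σ)
  Ψ-⇔ τ m a σ split =
    toΠ¹₁-⇔ (PairLen splitLayer) _
    ⟨⇔⟩ PairLen-⇔ splitLayer τ m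
    ⟨⇔⟩ all²-imp-pinned (PairF (var (# 2)) (var (# 1)) (var (# 0))) prefixLayer ρ₄ a c
          (λ a' c' → PairF-⇔ (var (# 2)) (var (# 1)) (var (# 0)) (λ _ → O) (extend c' (extend a' ρ₄))
                     ⟨⇔⟩ ≡⇒⇔ (cong (_≡ pair a' c') split) ⟨⇔⟩ pair≡pair⇔ a c a' c')
    ⟨⇔⟩ all-imp-pinned (PreF (var (# 0)) (var (# 5)) (var (# 2))) pairLayer ρ₆ u
          (λ u' → PreF-⇔ (var (# 0)) (var (# 5)) (var (# 2)) (extend u' ρ₆) ⟨⇔⟩ IsPrefix-⇔ u' τ a)
    ⟨⇔⟩ all-imp-pinned (PairF (var (# 0)) (var (# 1)) (var (# 2))) body ρ₇ (pair u c)
          (λ y → PairF-⇔ (var (# 0)) (var (# 1)) (var (# 2)) (λ _ → O) (extend y ρ₇))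
    ⟨⇔⟩ (BitF-⇔ (var (# 2)) (var (# 5)) (bitTerm b) ρ₈
          ⟨⇔⟩ ≡⇒⇔ (cong (_≡ bitCode c m) (evalT-bitTerm b ρ₈)) ⟨⇔⟩ encBit≡bitCode-⇔ (just b) σ m)
        ×-⇔ ⇔-sym (Φ⇔ (take a τ) σ)
    where
    c = codeStr σ
    u = codeStr (take a τ)
    ρ₄ = extend (length τ) (extend m (extend (codeStr τ) (λ _ → pair (codeStr τ) m)))
    ρ₆ = extend c (extend a ρ₄)
    ρ₇ = extend u ρ₆
    ρ₈ = extend (pair u c) ρ₇

  Ψ-sound : ∀ τ m → Ψ τ m → τ ≼ Y → X m ≡ b
  Ψ-sound τ m ψ τ≼Y with length-split τ | X m ≟ᵇ b
  ... | _ | yes X≡b = X≡b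
  ... | a , σ , split | no X≢b =
    ⊥-elim (proj₂ (Φ[Y]≡X m) (take a τ) σ Φτσ (take-≼ a τ Y τ≼Y)
                  (trans σ≡b (cong just (¬-not (λ b≡X → X≢b (sym b≡X))))))
    where
    σ≡b = proj₁ (to (Ψ-⇔ τ m a σ split) ψ)
    Φτσ = proj₂ (to (Ψ-⇔ τ m a σ split) ψ)

  Ψ-complete : ∀ m → X m ≡ b → Ψ ^ Y ∋ m
  Ψ-complete m X≡b with proj₁ (Φ[Y]≡X m)
  ... | τ₀ , σ , Φτ₀σ , τ₀≼Y , σ≡X =
    τ ,
    from (Ψ-⇔ τ m (length τ₀) σ (length-prefix Y _))
         (trans σ≡X (cong just X≡b) , subst (λ t → Φ t σ) (sym take≡τ₀) Φτ₀σ) ,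
    prefix-≼ Y _
    where
    τ = prefix Y (pair (length τ₀) (codeStr σ))
    take≡τ₀ : take (length τ₀) τ ≡ τ₀
    take≡τ₀ = trans (take-prefix Y (m≤pair _ _)) (sym (≼⇒≡prefix τ₀ Y τ₀≼Y))

  higherCE : HigherCE (λ m → X m ≡ b) Y
  higherCE = Ψ , (toΠ¹₁ (PairLen splitLayer) , λ τ m → ⇔-refl) ,
    λ m → mk⇔ (Ψ-complete m) (λ (τ , ψ , τ≼Y) → Ψ-sound τ m ψ τ≼Y)

-- (2) ⇒ (1)

Bool-cases-⇔ : {c : Maybe Bool} {P : Bool → Set} →
  ((c ≡ just true → P true) × (c ≡ just false → P false)) ⇔ (∀ b → c ≡ just b → P b)
Bool-cases-⇔ = mk⇔ (λ { (t , f) true → t ; (t , f) false → f }) (λ h → h true , h false)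

module FunctionalFromHigherCE (X Y : Real) (Ψ : Bool → EnumFunctional) (φ : Bool → Formula 1 1)
    (Ψ⇔ : ∀ b τ m → Ψ b τ m ⇔ Π¹₁Holds (φ b) (pair (codeStr τ) m))
    (Ψ^Y : ∀ b m → (X m ≡ b) ⇔ (Ψ b ^ Y ∋ m)) where

  -- Variables, innermost first: y u ℓ i n t s x.
  body : PosForm 8
  body = and (imp (BitF (var (# 5)) (var (# 3)) (bitTerm true)) (inst (φ true) (var (# 0))))
             (imp (BitF (var (# 5)) (var (# 3)) (bitTerm false)) (inst (φ false) (var (# 0))))

  pairLayer : PosForm 7
  pairLayer = all (imp (PairF (var (# 0)) (var (# 1)) (var (# 3))) body)

  prefixLayer : PosForm 6
  prefixLayer = all (imp (PreF (var (# 0)) (var (# 5)) (var (# 1))) pairLayer)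

  listLayer : PosForm 5
  listLayer = all (imp (ListF (var (# 2)) (var (# 1)) (var (# 0))) prefixLayer)

  Φ : Functional
  Φ τ σ = Π¹₁Holds (toΠ¹₁ (PairLen (all listLayer))) (pair (codeStr τ) (codeStr σ))

  Witnesses : Str → Str → Set
  Witnesses τ σ = ∀ i b → bit σ i ≡ just b → Ψ b (take (listAt (length τ) i) τ) i

  Φ-⇔ : ∀ τ σ → Φ τ σ ⇔ Witnesses τ σ
  Φ-⇔ τ σ =
    toΠ¹₁-⇔ (PairLen (all listLayer)) _
    ⟨⇔⟩ PairLen-⇔ (all listLayer) τ (codeStr σ)
    ⟨⇔⟩ Π-cong-⇔ listLayer-⇔
    where
    ρ₄ = extend (length τ) (extend (codeStr σ) (extend (codeStr τ) (λ _ → pair (codeStr τ) (codeStr σ))))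
    listLayer-⇔ : ∀ i → ⟦ listLayer ⟧ (extend i ρ₄) ⇔
                        (∀ b → bit σ i ≡ just b → Ψ b (take (listAt (length τ) i) τ) i)
    listLayer-⇔ i =
      all-imp-pinned (ListF (var (# 2)) (var (# 1)) (var (# 0))) prefixLayer ρ₅ ℓ
        (λ ℓ' → ListF-⇔ (var (# 2)) (var (# 1)) (var (# 0)) (extend ℓ' ρ₅))
      ⟨⇔⟩ all-imp-pinned (PreF (var (# 0)) (var (# 5)) (var (# 1))) pairLayer ρ₆ u
        (λ u' → PreF-⇔ (var (# 0)) (var (# 5)) (var (# 1)) (extend u' ρ₆) ⟨⇔⟩ IsPrefix-⇔ u' τ ℓ)
      ⟨⇔⟩ all-imp-pinned (PairF (var (# 0)) (var (# 1)) (var (# 3))) body ρ₇ (pair u i)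
        (λ y → PairF-⇔ (var (# 0)) (var (# 1)) (var (# 3)) (λ _ → O) (extend y ρ₇))
      ⟨⇔⟩ read true ×-⇔ read false
      ⟨⇔⟩ Bool-cases-⇔
      where
      ρ₅ = extend i ρ₄
      ℓ = listAt (length τ) i
      u = codeStr (take ℓ τ)
      ρ₆ = extend ℓ ρ₅
      ρ₇ = extend u ρ₆
      ρ₈ = extend (pair u i) ρ₇
      read : ∀ b → ⟦ imp (BitF (var (# 5)) (var (# 3)) (bitTerm b)) (inst (φ b) (var (# 0))) ⟧ ρ₈ ⇔
                   (bit σ i ≡ just b → Ψ b (take ℓ τ) i)
      read b = →-cong-⇔
        (BitF-⇔ (var (# 5)) (var (# 3)) (bitTerm b) ρ₈
          ⟨⇔⟩ ≡⇒⇔ (cong (_≡ bitCode (codeStr σ) i) (evalT-bitTerm b ρ₈))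
          ⟨⇔⟩ encBit≡bitCode-⇔ (just b) σ i)
        (⇔-sym (Ψ⇔ b (take ℓ τ) i))

  Φ-consistent : ∀ m τ σ → Φ τ σ → τ ≼ Y → bit σ m ≡ just (not (X m)) → ⊥
  Φ-consistent m τ σ Φτσ τ≼Y σ≡¬X = not-¬ refl (from (Ψ^Y (not (X m)) m) (τ' , Ψτ' , take-≼ ℓ τ Y τ≼Y))
    where
    ℓ = listAt (length τ) m
    τ' = take ℓ τ
    Ψτ' : Ψ (not (X m)) τ' m
    Ψτ' = to (Φ-⇔ τ σ) Φτσ m (not (X m)) σ≡¬X

  -- τ is a prefix of Y long enough to contain a Ψ_{X(i)}-witness for each
  -- i ≤ m, its length coding the list of their lengths.
  Φ-witness : ∀ m → Σ Str λ τ → Σ Str λ σ → Φ τ σ × τ ≼ Y × bit σ m ≡ just (X m)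
  Φ-witness m = τ , σ , from (Φ-⇔ τ σ) witnesses , prefix-≼ Y N , bit-prefix X ≤-refl
    where
    σ = prefix X (suc m)
    witness : ∀ i → Ψ (X i) ^ Y ∋ i
    witness i = to (Ψ^Y (X i) i) refl
    L : ℕ → ℕ
    L i = length (proj₁ (witness i))
    N = codeList L (suc m)
    τ = prefix Y N
    take≡witness : ∀ i → i < suc m → take (listAt (length τ) i) τ ≡ proj₁ (witness i)
    take≡witness i i< = begin
      take (listAt (length τ) i) τ  ≡⟨ cong (λ n → take (listAt n i) τ) (length-prefix Y N) ⟩
      take (listAt N i) τ           ≡⟨ cong (λ ℓ → take ℓ τ) (listAt-codeList (suc m) L i<) ⟩
      take (L i) τ                  ≡⟨ take-prefix Y (≤codeList (suc m) L i<) ⟩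
      prefix Y (L i)                ≡⟨ sym (≼⇒≡prefix _ Y (proj₂ (proj₂ (witness i)))) ⟩
      proj₁ (witness i)             ∎
      where open ≡-Reasoning
    witnesses : Witnesses τ σ
    witnesses i b σᵢ≡b =
      subst₂ (λ b' τ' → Ψ b' τ' i) X≡b (sym (take≡witness i i<)) (proj₁ (proj₂ (witness i)))
      where
      i< : i < suc m
      i< = subst (i <_) (length-prefix X (suc m)) (bit≡just⇒<length σ σᵢ≡b)
      X≡b : X i ≡ b
      X≡b = just-injective (trans (sym (bit-prefix X i<)) σᵢ≡b)

  functional : X ≤ω₁T Y
  functional = Φ , (toΠ¹₁ (PairLen (all listLayer)) , λ τ σ → ⇔-refl) , λ m → Φ-witness m , Φ-consistent m

proposition1p6 : (X Y : Real) →
    (X ≤ω₁T Y) ⇔ (HigherCE (λ m → X m ≡ true) Y × HigherCE (λ m → X m ≡ false) Y)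
proposition1p6 X Y = mk⇔
  (λ (Φ , (φ , Φ⇔) , Φ[Y]≡X) →
    let module CE = HigherCEFromFunctional X Y Φ φ Φ⇔ Φ[Y]≡X in
    CE.higherCE true , CE.higherCE false)
  (λ ((Ψ₁ , (φ₁ , Ψ₁⇔) , Ψ₁^Y) , (Ψ₀ , (φ₀ , Ψ₀⇔) , Ψ₀^Y)) →
    FunctionalFromHigherCE.functional X Y
      (λ b → if b then Ψ₁ else Ψ₀) (λ b → if b then φ₁ else φ₀)
      (λ { true → Ψ₁⇔ ; false → Ψ₀⇔ }) (λ { true → Ψ₁^Y ; false → Ψ₀^Y }))
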